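{- Let $n\ge 1$ and let $\alpha\preccurlyeq\beta$ be compositions of $n$. If a permutation $\sigma\in S_n$ is consistent with $\alpha\preccurlyeq\beta$, then $\sigma$ is consistent with $\alpha\preccurlyeq\gamma$ for every composition $\gamma$ with $\alpha\preccurlyeq\gamma\preccurlyeq\beta$.
   Context: A composition of $n$ is a sequence $\alpha=(\alpha_1,\dots,\alpha_k)$ of positive integers with sum $n$; $\ell(\alpha)=k$. For compositions $\alpha,\beta$ of $n$, $\alpha\preccurlyeq\beta$ ($\alpha$ refines $\beta$) means $\beta$ is obtained from $\alpha$ by summing consecutive blocks of parts of $\alpha$; then $\alpha^{(i)}$ denotes the consecutive block of parts of $\alpha$ summing to $\beta_i$. Consistency: write $\sigma\in S_n$ in one-line notation $\sigma(1)\sigma(2)\cdots\sigma(n)$. Cut this word into consecutive subwords $\sigma^1,\dots,\sigma^{\ell(\beta)}$ of lengths $\beta_1,\dots,\beta_{\ell(\beta)}$. For each $i$, cut $\sigma^i$ further into consecutive subwords of lengths given by the parts of $\alpha^{(i)}$ and regard each piece as a cycle. Then $\sigma$ is consistent with $\alpha\preccurlyeq\beta$ if for every $i$ these cycles of $\sigma^i$ are in standard form: each cycle has its largest element written last, and the largest elements of the successive cycles of $\sigma^i$ increase from left to right. -}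

module Defs where

open import Data.Nat using (ℕ; zero; suc; _<_; _≤_; _⊔_)
open import Data.Fin using (Fin; toℕ)
open import Data.Fin.Permutation using (Permutation′; _⟨$⟩ʳ_)
open import Data.List using (List; []; _∷_; _∷ʳ_; take; drop; map; concat; foldr; zip; allFin)
open import Data.Nat.ListAction using (sum)
open import Data.List.Relation.Unary.All using (All)
open import Data.List.Relation.Unary.Linked using (Linked)
open import Data.Product using (Σ; ∃; _×_; proj₁; proj₂)
open import Relation.Binary.PropositionalEquality using (_≡_)

IsComposition : ℕ → List ℕ → Set
IsComposition n α = All (0 <_) α × sum α ≡ n

-- α ≼ β : β is obtained from α by summing consecutive blocks of parts of α.
IsBlockDecomposition : List ℕ → List ℕ → List (List ℕ) → Set
IsBlockDecomposition α β blocks = concat blocks ≡ α × map sum blocks ≡ β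

Refines : List ℕ → List ℕ → Set
Refines α β = ∃ λ blocks → IsBlockDecomposition α β blocks

cut : {A : Set} → List ℕ → List A → List (List A)
cut []       xs = []
cut (k ∷ ks) xs = take k xs ∷ cut ks (drop k xs)

-- One-line notation σ(1) σ(2) ⋯ σ(n), with values in {1,…,n}.
oneLine : ∀ {n} → Permutation′ n → List ℕ
oneLine {n} σ = map (λ i → suc (toℕ (σ ⟨$⟩ʳ i))) (allFin n)

maxElt : List ℕ → ℕ
maxElt = foldr _⊔_ 0

LargestLast : List ℕ → Set
LargestLast c = Σ (List ℕ) λ init → Σ ℕ λ x → c ≡ init ∷ʳ x × All (_≤ x) init

StandardForm : List (List ℕ) → Set
StandardForm cycles = All LargestLast cycles × Linked _<_ (map maxElt cycles)

-- σ is consistent with α ≼ β: cutting the one-line word of σ into σ^1,…,σ^ℓ(β)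
-- of lengths β, and each σ^i into cycles of lengths α^{(i)}, all the
-- resulting families of cycles are in standard form.
ConsistentWith : ∀ {n} → Permutation′ n → (List (List ℕ)) → List ℕ → Set
ConsistentWith σ blocks β =
  All (λ p → StandardForm (cut (proj₁ p) (proj₂ p))) (zip blocks (cut β (oneLine σ)))

Consistent : ∀ {n} → Permutation′ n → List ℕ → List ℕ → Set
Consistent σ α β = ∃ λ blocks → IsBlockDecomposition α β blocks × ConsistentWith σ blocks β

module Submission where

-- Let B, C, G be the block decompositions witnessing α ≼ β,
-- α ≼ γ and γ ≼ β.  Since ConsistentWith σ B β only looks at the windows
-- of the one-line word of σ cut by β = map sum B, we study the predicate
-- "BlockwiseStandard B w" for an arbitrary word w and prove:
--   (1) standard form is inherited by both halves of a concatenation of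
--       cycle lists, so a standard-form family cut by concat C gives a
--       blockwise-standard family for every block list C (a coarse block
--       may be split into finer blocks);
--   (2) grouping the blocks C of α ≼ γ along the blocks G of γ ≼ β yields
--       Cs with concat Cs ≡ C, and, because α has positive parts, the
--       merged groups map concat Cs are exactly the blocks B of α ≼ β
--       (block lists of a positive list are determined by their sums).
-- The theorem follows: the B-consistency of σ is blockwise-standardness
-- for map concat Cs, which by (1) refines to the one for concat Cs ≡ C.

open import Defs
open import Data.Nat using (ℕ; _+_; _≤_; _<_; s≤s)
open import Data.Nat.Properties using (+-cancelˡ-≡; m≤m+n; m≤n⇒m⊓n≡m)
open import Data.Nat.ListAction using (sum)
open import Data.Nat.ListAction.Properties using (sum-++)
open import Data.List using (List; []; _∷_; _++_; take; drop; map; concat; zip)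
open import Data.List.Properties
  using (∷-injective; map-++; map-cong; map-∘; concat-concat; ++-cancelˡ;
         take-take; take-drop; drop-drop)
open import Data.List.Relation.Unary.All using (All; []; _∷_)
open import Data.List.Relation.Unary.All.Properties using (++⁻; ++⁻ˡ; ++⁻ʳ)
open import Data.List.Relation.Unary.Linked as Linked using (Linked; []; [-]; _∷_)
open import Data.Fin.Permutation using (Permutation′)
open import Data.Product using (Σ; _×_; _,_; proj₁; proj₂; map₁)
open import Relation.Binary.PropositionalEquality
  using (_≡_; refl; sym; trans; cong; subst; module ≡-Reasoning)
open ≡-Reasoning
open import Function using (_∘_)

take-of-take : ∀ {A : Set} k m (u : List A) → take k (take (k + m) u) ≡ take k u
take-of-take k m u =
  trans (take-take k (k + m) u) (cong (λ j → take j u) (m≤n⇒m⊓n≡m (m≤m+n k m)))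

cut-++ : ∀ {A : Set} (c r : List ℕ) (u : List A) →
  cut (c ++ r) u ≡ cut c (take (sum c) u) ++ cut r (drop (sum c) u)
cut-++ []      r u = refl
cut-++ (k ∷ c) r u
  rewrite cut-++ c r (drop k u) | take-of-take k (sum c) u
        | take-drop (sum c) k u | drop-drop k (sum c) u = refl

linked-++⁻ : ∀ {A : Set} {R : A → A → Set} (xs : List A) {ys : List A} →
  Linked R (xs ++ ys) → Linked R xs × Linked R ys
linked-++⁻ []           l       = [] , l
linked-++⁻ (x ∷ [])     l       = [-] , Linked.tail l
linked-++⁻ (x ∷ y ∷ xs) (r ∷ l) = map₁ (r ∷_) (linked-++⁻ (y ∷ xs) l)

standardForm-++⁻ : ∀ (xs : List (List ℕ)) {ys} →
  StandardForm (xs ++ ys) → StandardForm xs × StandardForm ys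
standardForm-++⁻ xs {ys} (last , increasing)
  with ++⁻ xs last | linked-++⁻ (map maxElt xs) (subst (Linked _<_) (map-++ maxElt xs ys) increasing)
... | lastˡ , lastʳ | incˡ , incʳ = (lastˡ , incˡ) , (lastʳ , incʳ)

-- For
-- w the one-line word of σ this is exactly ConsistentWith σ B (map sum B).
BlockwiseStandard : List (List ℕ) → List ℕ → Set
BlockwiseStandard B w =
  All (λ p → StandardForm (cut (proj₁ p) (proj₂ p))) (zip B (cut (map sum B) w))

blockwise-++ : ∀ C₁ C₂ w →
  BlockwiseStandard C₁ (take (sum (map sum C₁)) w) →
  BlockwiseStandard C₂ (drop (sum (map sum C₁)) w) →
  BlockwiseStandard (C₁ ++ C₂) w
blockwise-++ []       C₂ w []       s₂ = s₂
blockwise-++ (c ∷ C₁) C₂ w (p ∷ s₁) s₂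
  rewrite take-of-take (sum c) (sum (map sum C₁)) w | sym (take-drop (sum (map sum C₁)) (sum c) w)
        | sym (drop-drop (sum c) (sum (map sum C₁)) w) =
  p ∷ blockwise-++ C₁ C₂ (drop (sum c) w) s₁ s₂

-- A word whose cycles (cut by concat C) are in standard form is blockwise
-- standard for C: forgetting the comparisons across blocks.
standard⇒blockwise : ∀ C u → StandardForm (cut (concat C) u) → BlockwiseStandard C u
standard⇒blockwise []      u s = []
standard⇒blockwise (c ∷ C) u s
  with standardForm-++⁻ (cut c (take (sum c) u)) (subst StandardForm (cut-++ c (concat C) u) s)
... | sᶜ , sᶜˢ = sᶜ ∷ standard⇒blockwise C (drop (sum c) u) sᶜˢ

sum-concat : ∀ (C : List (List ℕ)) → sum (concat C) ≡ sum (map sum C)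
sum-concat []      = refl
sum-concat (c ∷ C) = trans (sum-++ c (concat C)) (cong (sum c +_) (sum-concat C))

blockwise-refine : ∀ Cs w →
  BlockwiseStandard (map concat Cs) w → BlockwiseStandard (concat Cs) w
blockwise-refine []       w []       = []
blockwise-refine (C ∷ Cs) w (p ∷ ps) =
  blockwise-++ C (concat Cs) w
    (at (λ k → BlockwiseStandard C (take k w)) (standard⇒blockwise C _ p))
    (at (λ k → BlockwiseStandard (concat Cs) (drop k w)) (blockwise-refine Cs _ ps))
  where
    at : (Q : ℕ → Set) → Q (sum (concat C)) → Q (sum (map sum C))
    at Q = subst Q (sum-concat C)

positive-sum-zero : ∀ xs → All (0 <_) xs → sum xs ≡ 0 → xs ≡ []
positive-sum-zero []      []          _  = refl
positive-sum-zero (_ ∷ _) (s≤s _ ∷ _) ()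

prefix-by-sum : ∀ xs ys xs′ ys′ → All (0 <_) (xs ++ ys) →
  xs ++ ys ≡ xs′ ++ ys′ → sum xs ≡ sum xs′ → xs ≡ xs′
prefix-by-sum [] ys xs′ ys′ pos e s =
  sym (positive-sum-zero xs′ (++⁻ˡ xs′ (subst (All (0 <_)) e pos)) (sym s))
prefix-by-sum (x ∷ xs) ys [] ys′ pos e s = positive-sum-zero (x ∷ xs) (++⁻ˡ (x ∷ xs) pos) s
prefix-by-sum (x ∷ xs) ys (x′ ∷ xs′) ys′ (_ ∷ pos) e s with ∷-injective e
... | refl , e′ = cong (x ∷_) (prefix-by-sum xs ys xs′ ys′ pos e′ (+-cancelˡ-≡ x _ _ s))

blocks-determined : ∀ B B′ → All (0 <_) (concat B) →
  concat B ≡ concat B′ → map sum B ≡ map sum B′ → B ≡ B′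
blocks-determined []      []        _   _ _ = refl
blocks-determined (b ∷ B) (b′ ∷ B′) pos e s with ∷-injective s
... | sᵇ , sᴮ with prefix-by-sum b (concat B) b′ (concat B′) pos e sᵇ
... | refl = cong (b ∷_)
  (blocks-determined B B′ (++⁻ʳ b pos) (++-cancelˡ b (concat B) (concat B′) e) sᴮ)

map-split : ∀ {A X : Set} (f : A → X) C g h → map f C ≡ g ++ h →
  Σ (List A) λ C₁ → Σ (List A) λ C₂ → C ≡ C₁ ++ C₂ × map f C₁ ≡ g × map f C₂ ≡ h
map-split f C       []      h e = [] , C , refl , refl , e
map-split f (c ∷ C) (x ∷ g) h e with ∷-injective e
... | refl , e′ with map-split f C g h e′
... | C₁ , C₂ , refl , refl , refl = c ∷ C₁ , C₂ , refl , refl , refl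

group : ∀ {A X : Set} (f : A → X) C G → map f C ≡ concat G →
  Σ (List (List A)) λ Cs → concat Cs ≡ C × map (map f) Cs ≡ G
group f []      []      _ = [] , refl , refl
group f C       (g ∷ G) e with map-split f C g (concat G) e
... | C₁ , C₂ , refl , refl , e₂ with group f C₂ G e₂
... | Cs , refl , refl = C₁ ∷ Cs , refl , refl

lemma3p8 : (n : ℕ) → 1 ≤ n → (α β γ : List ℕ) →
    IsComposition n α → IsComposition n β → IsComposition n γ →
    Refines α β → (σ : Permutation′ n) → Consistent σ α β →
    Refines α γ → Refines γ β → Consistent σ α γ
lemma3p8 _ _ _ _ _ (posα , _) _ _ _ σ (B , (refl , refl) , consistentB) (C , (αC , refl)) (G , (γG , βG))
  with group sum C G (sym γG)
... | Cs , refl , refl = concat Cs , (αC , refl) , blockwise-refine Cs (oneLine σ) consistentMerged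
  where
    mergedSums : map sum (map concat Cs) ≡ map sum B
    mergedSums = begin
      map sum (map concat Cs)       ≡⟨ sym (map-∘ Cs) ⟩
      map (sum ∘ concat) Cs         ≡⟨ map-cong sum-concat Cs ⟩
      map (sum ∘ map sum) Cs        ≡⟨ map-∘ Cs ⟩
      map sum (map (map sum) Cs)    ≡⟨ βG ⟩
      map sum B                     ∎
    merged≡B : map concat Cs ≡ B
    merged≡B = blocks-determined (map concat Cs) B
      (subst (All (0 <_)) (sym (trans (concat-concat Cs) αC)) posα)
      (trans (concat-concat Cs) αC)
      mergedSums
    consistentMerged : BlockwiseStandard (map concat Cs) (oneLine σ)
    consistentMerged = subst (λ B′ → BlockwiseStandard B′ (oneLine σ)) (sym merged≡B) consistentB
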